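{- Let $w\in S_n$ with primary column data $(h,C,\alpha,i_1,\beta)$. Then $w$ restricts to a bijection $[\alpha+1,i_1]\to[h-\beta+1,h]$. Moreover, the corresponding permutation $\sigma\in S_\beta$, $\sigma(p)=w(\alpha+p)-(h-\beta)$, is dominant.
   Context: $[m,n]=\{m,\ldots,n\}$, $[n]=[1,n]$. Rothe diagram: $D(w)=\{(i,j)\in[n]^2: i<w^{ -1}(j),\ j<w(i)\}$ (row $i$, column $j$); its $j$-th column is $D(w)_j=\{i:(i,j)\in D(w)\}$. A standard interval is a set $[j]$, $j\ge0$ ($[0]=\emptyset$). A permutation is dominant if there are no $i<j<k$ with $w(i)<w(k)<w(j)$, equivalently if all columns of $D(w)$ are standard intervals. A missing tooth of a column $C$ is a positive integer $i$ with $i\notin C$, $i+1\in C$. Primary column data of $w$: if $w$ is not dominant, $h$ is the smallest integer such that $D(w)_{h+1}$ is not a standard interval, $C=D(w)_{h+1}$, $\alpha$ is the largest integer with $[\alpha]\subseteq C$, $i_1$ is the smallest missing tooth of $C$, and $\beta=i_1-\alpha$. If $w$ is dominant, $h=n$, $C=\emptyset$, $\alpha=0$, $i_1=n$, $\beta=n$. -}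

module Defs where

open import Data.Nat using (ℕ; zero; suc; _+_; _∸_; _≤_; _<_; _<?_)
open import Data.Fin using (Fin; toℕ; fromℕ<)
open import Data.Fin.Permutation using (Permutation′; _⟨$⟩ʳ_; _⟨$⟩ˡ_)
open import Data.Product using (Σ; _×_; ∃)
open import Relation.Nullary using (¬_; yes; no)
open import Function.Bundles using (_⇔_)
open import Relation.Binary.PropositionalEquality using (_≡_)
open import Data.Sum using (_⊎_)

Perm : ℕ → Set
Perm n = Permutation′ n

-- 1-based action of w on ℕ: for i ∈ [1,n], app w i = w(i) ∈ [1,n];
-- outside [1,n] the value is 0 (never used for statements inside [n]).
app : ∀ {n} → Perm n → ℕ → ℕ
app {n} w zero = 0
app {n} w (suc i) with i <? n
... | yes p = suc (toℕ (w ⟨$⟩ʳ fromℕ< p))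
... | no _ = 0

appInv : ∀ {n} → Perm n → ℕ → ℕ
appInv {n} w zero = 0
appInv {n} w (suc j) with j <? n
... | yes p = suc (toℕ (w ⟨$⟩ˡ fromℕ< p))
... | no _ = 0

InD : ∀ {n} → Perm n → ℕ → ℕ → Set
InD {n} w i j = (1 ≤ i × i ≤ n) × (1 ≤ j × j ≤ n) × (i < appInv w j × j < app w i)

Col : ∀ {n} → Perm n → ℕ → ℕ → Set
Col w j i = InD w i j

StandardInterval : (ℕ → Set) → Set
StandardInterval C = ∃ λ k → ∀ i → C i ⇔ (1 ≤ i × i ≤ k)

InitialSeg⊆ : ℕ → (ℕ → Set) → Set
InitialSeg⊆ a C = ∀ i → 1 ≤ i → i ≤ a → C i

MissingTooth : (ℕ → Set) → ℕ → Set
MissingTooth C i = 1 ≤ i × ¬ C i × C (suc i)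

-- A function f on [m] avoids the pattern 132:
-- no i<j<k in [m] with f(i) < f(k) < f(j).
DominantFn : ℕ → (ℕ → ℕ) → Set
DominantFn m f = ∀ i j k → 1 ≤ i → i < j → j < k → k ≤ m →
                 ¬ (f i < f k × f k < f j)

Dominant : ∀ {n} → Perm n → Set
Dominant {n} w = DominantFn n (app w)

PrimaryColumnData : ∀ {n} → Perm n → ℕ → (ℕ → Set) → ℕ → ℕ → ℕ → Set
PrimaryColumnData {n} w h C α i₁ β =
    (Dominant w × h ≡ n × (∀ i → ¬ C i) × α ≡ 0 × i₁ ≡ n × β ≡ n)
  ⊎ (¬ Dominant w
      × ¬ StandardInterval (Col w (suc h))
      × (∀ h′ → h′ < h → StandardInterval (Col w (suc h′)))
      × (∀ i → C i ⇔ Col w (suc h) i)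
      × InitialSeg⊆ α C
      × (∀ a → InitialSeg⊆ a C → a ≤ α)
      × MissingTooth C i₁
      × (∀ i → MissingTooth C i → i₁ ≤ i)
      × β ≡ i₁ ∸ α)

-- The rows α+1,…,i₁ avoid column h+1 although row i₁+1 lies in it, which forces
-- w(i) ≤ h on them; and a value j ≤ h either has its preimage among these rows,
-- or column j (a standard interval containing i₁+1) lies below all of them.
-- Pigeonhole arguments on the intervals [α+1,i₁] and [h-β+1,h] then show that w
-- maps the first onto the second, and a 132-pattern i<j<k inside it would put
-- row j, hence row i, into the standard column w(k), contradicting w(i) < w(k).
module Submission where

open import Defs
open import Data.Nat using (ℕ; suc; _+_; _∸_; _≤_; _<_; z≤n; s≤s; s≤s⁻¹)
open import Data.Nat.Properties
open import Data.Fin using (Fin; toℕ; fromℕ<)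
open import Data.Fin.Properties using (pigeonhole; toℕ-fromℕ<; fromℕ<-toℕ; toℕ<n)
open import Data.Fin.Permutation using (_⟨$⟩ʳ_; _⟨$⟩ˡ_; inverseˡ; inverseʳ)
open import Data.Product using (_×_; ∃; Σ; _,_; proj₁; proj₂)
open import Data.Sum using (_⊎_; inj₁; inj₂)
open import Data.Empty using (⊥-elim)
open import Relation.Nullary using (¬_; yes; no; contradiction)
open import Relation.Binary.Definitions using (tri<; tri≈; tri>)
open import Function.Bundles using (Equivalence; _⇔_)
open import Relation.Binary.PropositionalEquality

infix 4 _∈⟨_,_]

_∈⟨_,_] : ℕ → ℕ → ℕ → Set
i ∈⟨ a , b ] = a < i × i ≤ b

∈⟨⟩-lowerTo0 : ∀ {a b i} → i ∈⟨ a , b ] → i ∈⟨ 0 , b ]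
∈⟨⟩-lowerTo0 (a<i , i≤b) = ≤-<-trans z≤n a<i , i≤b

InjectiveOn : (ℕ → Set) → (ℕ → ℕ) → Set
InjectiveOn P f = ∀ {i i′} → P i → P i′ → f i ≡ f i′ → i ≡ i′

m∸o<n∸o⇒m<n : ∀ {m n} o → m ∸ o < n ∸ o → m < n
m∸o<n∸o⇒m<n o m∸o<n∸o = ≰⇒> λ n≤m → <⇒≱ m∸o<n∸o (∸-monoˡ-≤ o n≤m)

m<n∸o⇒m+o<n : ∀ {m n o} → m < n ∸ o → m + o < n
m<n∸o⇒m+o<n {m} {n} {o} m<n∸o = m≤o∸n⇒m+n≤o (suc m) o≤n m<n∸o
  where
  o≤n : o ≤ n
  o≤n = <⇒≤ (m∸n≢0⇒n<m λ n∸o≡0 → n≮0 (subst (m <_) n∸o≡0 m<n∸o))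

injection-below⇒≤ : ∀ {k m} (f : ℕ → ℕ) →
  (∀ {x} → x < k → f x < m) → InjectiveOn (_< k) f → k ≤ m
injection-below⇒≤ {k} {m} f f< f-injective = ≮⇒≥ no-collision
  where
  g : Fin k → Fin m
  g x = fromℕ< (f< (toℕ<n x))

  toℕ-g : ∀ x → toℕ (g x) ≡ f (toℕ x)
  toℕ-g x = toℕ-fromℕ< (f< (toℕ<n x))

  no-collision : ¬ (m < k)
  no-collision m<k with pigeonhole m<k g
  ... | x , y , x<y , gx≡gy =
    <⇒≢ x<y (f-injective (toℕ<n x) (toℕ<n y)
      (trans (sym (toℕ-g x)) (trans (cong toℕ gx≡gy) (toℕ-g y))))

injection-between-intervals⇒≤ : ∀ {a b c d} (f : ℕ → ℕ) →
  (∀ {i} → i ∈⟨ a , b ] → f i ∈⟨ c , d ]) →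
  InjectiveOn (_∈⟨ a , b ]) f → b ∸ a ≤ d ∸ c
injection-between-intervals⇒≤ {a} {b} {c} {d} f f∈ f-injective =
  injection-below⇒≤ g g< g-injective
  where
  shift : ℕ → ℕ
  shift x = suc (x + a)

  shift∈ : ∀ {x} → x < b ∸ a → shift x ∈⟨ a , b ]
  shift∈ {x} x<b∸a = s≤s (m≤n+m a x) , m<n∸o⇒m+o<n x<b∸a

  g : ℕ → ℕ
  g x = f (shift x) ∸ suc c

  g< : ∀ {x} → x < b ∸ a → g x < d ∸ c
  g< x<b∸a = let c<f , f≤d = f∈ (shift∈ x<b∸a) in ∸-monoˡ-< (s≤s f≤d) c<f

  g-injective : InjectiveOn (_< b ∸ a) g
  g-injective {x} {x′} x< x′< gx≡gx′ =
    +-cancelʳ-≡ a x x′ (suc-injective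
      (f-injective (shift∈ x<) (shift∈ x′<)
        (∸-cancelʳ-≡ (proj₁ (f∈ (shift∈ x<))) (proj₁ (f∈ (shift∈ x′<))) gx≡gx′)))

standardInterval-downClosed : ∀ {P : ℕ → Set} → StandardInterval P →
  ∀ {a b} → 0 < a → a ≤ b → P b → P a
standardInterval-downClosed (_ , P⇔) {a} {b} 0<a a≤b Pb =
  Equivalence.from (P⇔ a) (0<a , ≤-trans a≤b (proj₂ (Equivalence.to (P⇔ b) Pb)))

initialSeg⊆-extend : ∀ {a} {P : ℕ → Set} → InitialSeg⊆ a P → P (suc a) → InitialSeg⊆ (suc a) P
initialSeg⊆-extend seg Pa+1 i 0<i i≤1+a with m≤n⇒m<n∨m≡n i≤1+a
... | inj₁ i<1+a = seg i 0<i (s≤s⁻¹ i<1+a)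
... | inj₂ refl = Pa+1

module PermAction {n} (w : Perm n) where

  private
    app-fin : (k : Fin n) → app w (suc (toℕ k)) ≡ suc (toℕ (w ⟨$⟩ʳ k))
    app-fin k with toℕ k <? n
    ... | yes k<n = cong (λ x → suc (toℕ (w ⟨$⟩ʳ x))) (fromℕ<-toℕ k k<n)
    ... | no k≮n = contradiction (toℕ<n k) k≮n

    appInv-fin : (k : Fin n) → appInv w (suc (toℕ k)) ≡ suc (toℕ (w ⟨$⟩ˡ k))
    appInv-fin k with toℕ k <? n
    ... | yes k<n = cong (λ x → suc (toℕ (w ⟨$⟩ˡ x))) (fromℕ<-toℕ k k<n)
    ... | no k≮n = contradiction (toℕ<n k) k≮n

    toFin : ∀ {i} → i ∈⟨ 0 , n ] → Σ (Fin n) λ k → i ≡ suc (toℕ k)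
    toFin {suc i} (_ , i<n) = fromℕ< i<n , cong suc (sym (toℕ-fromℕ< i<n))

  app-∈ : ∀ {i} → i ∈⟨ 0 , n ] → app w i ∈⟨ 0 , n ]
  app-∈ i∈ with toFin i∈
  ... | k , refl rewrite app-fin k = s≤s z≤n , toℕ<n _

  appInv-∈ : ∀ {i} → i ∈⟨ 0 , n ] → appInv w i ∈⟨ 0 , n ]
  appInv-∈ i∈ with toFin i∈
  ... | k , refl rewrite appInv-fin k = s≤s z≤n , toℕ<n _

  appInv-app : ∀ {i} → i ∈⟨ 0 , n ] → appInv w (app w i) ≡ i
  appInv-app i∈ with toFin i∈
  ... | k , refl rewrite app-fin k | appInv-fin (w ⟨$⟩ʳ k) | inverseˡ w {k} = refl

  app-appInv : ∀ {i} → i ∈⟨ 0 , n ] → app w (appInv w i) ≡ i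
  app-appInv i∈ with toFin i∈
  ... | k , refl rewrite appInv-fin k | app-fin (w ⟨$⟩ˡ k) | inverseʳ w {k} = refl

  app-injective : InjectiveOn (_∈⟨ 0 , n ]) (app w)
  app-injective i∈ i′∈ wi≡wi′ =
    trans (sym (appInv-app i∈)) (trans (cong (appInv w) wi≡wi′) (appInv-app i′∈))

  appInv-injective : InjectiveOn (_∈⟨ 0 , n ]) (appInv w)
  appInv-injective i∈ i′∈ w⁻¹i≡w⁻¹i′ =
    trans (sym (app-appInv i∈)) (trans (cong (app w) w⁻¹i≡w⁻¹i′) (app-appInv i′∈))

  -- Row b lies in column w(c); the column being standard, so does row a.
  standardColumn⇒¬132 : ∀ {a b c} → 0 < a → a < b → b < c → c ≤ n →
    StandardInterval (Col w (app w c)) → ¬ (app w a < app w c × app w c < app w b)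
  standardColumn⇒¬132 {a} {b} {c} 0<a a<b b<c c≤n column-standard (wa<wc , wc<wb) =
    <-asym wa<wc (proj₂ (proj₂ (proj₂ a∈column)))
    where
    0<b : 0 < b
    0<b = <-trans 0<a a<b

    c∈ : c ∈⟨ 0 , n ]
    c∈ = <-trans 0<b b<c , c≤n

    b∈column : InD w b (app w c)
    b∈column = (0<b , ≤-trans (<⇒≤ b<c) c≤n) , app-∈ c∈ ,
               subst (b <_) (sym (appInv-app c∈)) b<c , wc<wb

    a∈column : InD w a (app w c)
    a∈column = standardInterval-downClosed column-standard 0<a (<⇒≤ a<b) b∈column

module NonDominant {n} (w : Perm n) {h : ℕ} {C : ℕ → Set} {α i₁ β : ℕ}
  (columns-standard : ∀ h′ → h′ < h → StandardInterval (Col w (suc h′)))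
  (C⇔column : ∀ i → C i ⇔ Col w (suc h) i)
  (α-initial : InitialSeg⊆ α C)
  (α-maximal : ∀ a → InitialSeg⊆ a C → a ≤ α)
  (i₁-tooth : MissingTooth C i₁)
  (i₁-minimal : ∀ i → MissingTooth C i → i₁ ≤ i)
  (β≡i₁∸α : β ≡ i₁ ∸ α)
  where

  open PermAction w
  open ≤-Reasoning

  Middle : ℕ → Set
  Middle = _∈⟨ α , i₁ ]

  i₁+1∈column : InD w (suc i₁) (suc h)
  i₁+1∈column = Equivalence.to (C⇔column (suc i₁)) (proj₂ (proj₂ i₁-tooth))

  i₁<n : i₁ < n
  i₁<n = proj₂ (proj₁ i₁+1∈column)

  h<n : h < n
  h<n = proj₂ (proj₁ (proj₂ i₁+1∈column))

  i₁+1<w⁻¹[h+1] : suc i₁ < appInv w (suc h)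
  i₁+1<w⁻¹[h+1] = proj₁ (proj₂ (proj₂ i₁+1∈column))

  h+1<w[i₁+1] : suc h < app w (suc i₁)
  h+1<w[i₁+1] = proj₂ (proj₂ (proj₂ i₁+1∈column))

  α<i₁ : α < i₁
  α<i₁ = ≰⇒> λ i₁≤α → proj₁ (proj₂ i₁-tooth) (α-initial i₁ (proj₁ i₁-tooth) i₁≤α)

  α+β≡i₁ : α + β ≡ i₁
  α+β≡i₁ = trans (cong (α +_) β≡i₁∸α) (m+[n∸m]≡n (<⇒≤ α<i₁))

  middle-∉C : ∀ {i} → Middle i → ¬ C i
  middle-∉C {suc i} (α<1+i , 1+i≤i₁) C[1+i] with m≤n⇒m<n∨m≡n (s≤s⁻¹ α<1+i)
  ... | inj₂ refl = 1+n≰n (α-maximal (suc α) (initialSeg⊆-extend α-initial C[1+i]))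
  ... | inj₁ α<i  = 1+n≰n (≤-trans 1+i≤i₁ (i₁-minimal i (≤-<-trans z≤n α<i , ¬C[i] , C[1+i])))
    where
    ¬C[i] : ¬ C i
    ¬C[i] = middle-∉C (α<i , ≤-trans (n≤1+n i) 1+i≤i₁)

  middle-∈[n] : ∀ {i} → Middle i → i ∈⟨ 0 , n ]
  middle-∈[n] (α<i , i≤i₁) = ∈⟨⟩-lowerTo0 (α<i , ≤-trans i≤i₁ (<⇒≤ i₁<n))

  middle-injective : InjectiveOn Middle (app w)
  middle-injective i∈ i′∈ = app-injective (middle-∈[n] i∈) (middle-∈[n] i′∈)

  middle-≤h : ∀ {i} → Middle i → app w i ∈⟨ 0 , h ]
  middle-≤h {i} i∈ = proj₁ (app-∈ i∈[n]) , ≮⇒≥ ¬h<wi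
    where
    i∈[n] = middle-∈[n] i∈

    i<w⁻¹[h+1] : i < appInv w (suc h)
    i<w⁻¹[h+1] = <-trans (s≤s (proj₂ i∈)) i₁+1<w⁻¹[h+1]

    ¬h<wi : ¬ (h < app w i)
    ¬h<wi h<wi with m≤n⇒m<n∨m≡n h<wi
    ... | inj₁ h+1<wi = middle-∉C i∈ (Equivalence.from (C⇔column i)
            (i∈[n] , (s≤s z≤n , h<n) , i<w⁻¹[h+1] , h+1<wi))
    ... | inj₂ h+1≡wi = <-irrefl (trans (sym (appInv-app i∈[n])) (cong (appInv w) (sym h+1≡wi)))
                                 i<w⁻¹[h+1]

  column-standard : ∀ {j} → j ∈⟨ 0 , h ] → StandardInterval (Col w j)
  column-standard {suc j} (_ , j<h) = columns-standard j j<h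

  ≤h-∈[n] : ∀ {j} → j ∈⟨ 0 , h ] → j ∈⟨ 0 , n ]
  ≤h-∈[n] (0<j , j≤h) = 0<j , ≤-trans j≤h (<⇒≤ h<n)

  initial-above-h+1 : ∀ {r} → r ∈⟨ 0 , α ] → suc h < app w r
  initial-above-h+1 (0<r , r≤α) =
    proj₂ (proj₂ (proj₂ (Equivalence.to (C⇔column _) (α-initial _ 0<r r≤α))))

  preimage-not-above-h+1 : ∀ {j} → j ∈⟨ 0 , h ] → ¬ (suc h < app w (appInv w j))
  preimage-not-above-h+1 j∈@(_ , j≤h) h+1<wr =
    <⇒≱ h+1<wr (subst (_≤ suc h) (sym (app-appInv (≤h-∈[n] j∈))) (≤-trans j≤h (n≤1+n h)))

  -- Rows 1,…,α lie in column h+1 and w(i₁+1) > h+1, so a preimage of j ≤ h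
  -- outside the middle rows lies below row i₁+1, which then belongs to column j.
  middle-preimage-or-below : ∀ {j} → j ∈⟨ 0 , h ] →
    Middle (appInv w j) ⊎ (∀ {i} → Middle i → j < app w i)
  middle-preimage-or-below {j} j∈@(_ , j≤h) with <-cmp (appInv w j) (suc i₁)
  ... | tri> _ _ i₁+1<r = inj₂ λ i∈ → proj₂ (proj₂ (proj₂
          (standardInterval-downClosed (column-standard j∈)
            (proj₁ (middle-∈[n] i∈)) (≤-trans (proj₂ i∈) (n≤1+n i₁))
            ((s≤s z≤n , i₁<n) , ≤h-∈[n] j∈ , i₁+1<r , <-trans (s≤s j≤h) h+1<w[i₁+1]))))
  ... | tri≈ _ r≡i₁+1 _ = contradiction
          (subst (λ r → suc h < app w r) (sym r≡i₁+1) h+1<w[i₁+1])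
          (preimage-not-above-h+1 j∈)
  ... | tri< r<i₁+1 _ _ with appInv w j ≤? α
  ...   | yes r≤α = contradiction
          (initial-above-h+1 (proj₁ (appInv-∈ (≤h-∈[n] j∈)) , r≤α))
          (preimage-not-above-h+1 j∈)
  ...   | no r≰α = inj₁ (≰⇒> r≰α , s≤s⁻¹ r<i₁+1)

  β≤h : β ≤ h
  β≤h = begin
    β      ≡⟨ β≡i₁∸α ⟩
    i₁ ∸ α ≤⟨ injection-between-intervals⇒≤ (app w) middle-≤h middle-injective ⟩
    h      ∎

  -- If w(i) = u+1 for a middle row i, every value in [u+1, u+1+β] ⊆ [1,h] has
  -- its preimage among the β middle rows.
  middle-value-too-low : ∀ {i u} → Middle i → app w i ≡ suc u → ¬ (u + suc β ≤ h)
  middle-value-too-low {i} {u} i∈ wi≡u+1 top≤h = 1+n≰n (begin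
    suc β              ≡⟨ m+n∸m≡n u (suc β) ⟨
    u + suc β ∸ u      ≤⟨ injection-between-intervals⇒≤ (appInv w) window→middle window-injective ⟩
    i₁ ∸ α             ≡⟨ β≡i₁∸α ⟨
    β                  ∎)
    where
    Window : ℕ → Set
    Window = _∈⟨ u , u + suc β ]

    window-≤h : ∀ {j} → Window j → j ∈⟨ 0 , h ]
    window-≤h (u<j , j≤top) = ∈⟨⟩-lowerTo0 (u<j , ≤-trans j≤top top≤h)

    window→middle : ∀ {j} → Window j → Middle (appInv w j)
    window→middle j∈@(u<j , _) with middle-preimage-or-below (window-≤h j∈)
    ... | inj₁ r∈ = r∈
    ... | inj₂ below-middle = ⊥-elim (<⇒≱ u<j (s≤s⁻¹ (subst (_ <_) wi≡u+1 (below-middle i∈))))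

    window-injective : InjectiveOn Window (appInv w)
    window-injective j∈ j′∈ = appInv-injective (≤h-∈[n] (window-≤h j∈)) (≤h-∈[n] (window-≤h j′∈))

  middle-above-h∸β : ∀ {i} → Middle i → h ∸ β < app w i
  middle-above-h∸β {i} i∈ with app w i in wi≡v | middle-≤h i∈
  ... | suc u | _ = ≰⇒> λ u+1≤h∸β → middle-value-too-low i∈ wi≡v
          (subst (_≤ h) (sym (+-suc u β)) (m≤o∸n⇒m+n≤o (suc u) β≤h u+1≤h∸β))

  middle-∈window : ∀ {i} → Middle i → app w i ∈⟨ h ∸ β , h ]
  middle-∈window i∈ = middle-above-h∸β i∈ , proj₂ (middle-≤h i∈)

  window-⊆-image : ∀ {j} → j ∈⟨ h ∸ β , h ] → ∃ λ i → Middle i × app w i ≡ j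
  window-⊆-image {j} j∈@(h∸β<j , j≤h) with middle-preimage-or-below (∈⟨⟩-lowerTo0 j∈)
  ... | inj₁ r∈ = appInv w j , r∈ , app-appInv (≤h-∈[n] (∈⟨⟩-lowerTo0 j∈))
  ... | inj₂ below-middle = contradiction β+j≤h (<⇒≱ h<β+j)
    where
    β≤h∸j : β ≤ h ∸ j
    β≤h∸j = begin
      β      ≡⟨ β≡i₁∸α ⟩
      i₁ ∸ α ≤⟨ injection-between-intervals⇒≤ (app w)
                  (λ i∈ → below-middle i∈ , proj₂ (middle-≤h i∈)) middle-injective ⟩
      h ∸ j  ∎

    β+j≤h : β + j ≤ h
    β+j≤h = m≤o∸n⇒m+n≤o β j≤h β≤h∸j

    h<β+j : h < β + j
    h<β+j = begin-strict
      h           ≡⟨ m+[n∸m]≡n β≤h ⟨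
      β + (h ∸ β) <⟨ +-monoʳ-< β h∸β<j ⟩
      β + j       ∎

  σ-dominant : DominantFn β (λ p → app w (α + p) ∸ (h ∸ β))
  σ-dominant p q r 0<p p<q q<r r≤β (σp<σr , σr<σq) =
    standardColumn⇒¬132 (≤-trans 0<p (m≤n+m p α)) (+-monoʳ-< α p<q) (+-monoʳ-< α q<r)
      (proj₂ (middle-∈[n] α+r∈)) (column-standard (middle-≤h α+r∈))
      (m∸o<n∸o⇒m<n (h ∸ β) σp<σr , m∸o<n∸o⇒m<n (h ∸ β) σr<σq)
    where
    α+r∈ : Middle (α + r)
    α+r∈ = m<m+n α (<-trans 0<p (<-trans p<q q<r)) ,
           subst (α + r ≤_) α+β≡i₁ (+-monoʳ-≤ α r≤β)

lemma3p4 : ∀ n (w : Perm n) h (C : ℕ → Set) α i₁ β →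
    PrimaryColumnData w h C α i₁ β →
      (β ≤ h
      × (∀ i → suc α ≤ i → i ≤ i₁ → (suc (h ∸ β) ≤ app w i × app w i ≤ h))
      × (∀ i i′ → suc α ≤ i → i ≤ i₁ → suc α ≤ i′ → i′ ≤ i₁ → app w i ≡ app w i′ → i ≡ i′)
      × (∀ j → suc (h ∸ β) ≤ j → j ≤ h → ∃ λ i → suc α ≤ i × i ≤ i₁ × app w i ≡ j))
      × DominantFn β (λ p → app w (α + p) ∸ (h ∸ β))
lemma3p4 n w .n C .0 .n .n (inj₁ (w-dominant , refl , _ , refl , refl , refl))
  rewrite n∸n≡0 n =
  ( ≤-refl
  , (λ i 0<i i≤n → app-∈ (0<i , i≤n))
  , (λ i i′ 0<i i≤n 0<i′ i′≤n → app-injective (0<i , i≤n) (0<i′ , i′≤n))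
  , (λ j 0<j j≤n → let 0<r , r≤n = appInv-∈ (0<j , j≤n) in
                   appInv w j , 0<r , r≤n , app-appInv (0<j , j≤n)) )
  , w-dominant
  where open PermAction w
lemma3p4 n w h C α i₁ β
  (inj₂ (_ , _ , columns-standard , C⇔column , α-initial , α-maximal , i₁-tooth , i₁-minimal , β≡i₁∸α)) =
  ( β≤h
  , (λ i α<i i≤i₁ → middle-∈window (α<i , i≤i₁))
  , (λ i i′ α<i i≤i₁ α<i′ i′≤i₁ → middle-injective (α<i , i≤i₁) (α<i′ , i′≤i₁))
  , (λ j h∸β<j j≤h → let i , (α<i , i≤i₁) , wi≡j = window-⊆-image (h∸β<j , j≤h) in
                     i , α<i , i≤i₁ , wi≡j) )
  , σ-dominant
  where
  open NonDominant w columns-standard C⇔column α-initial α-maximal i₁-tooth i₁-minimal β≡i₁∸α
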